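{- Let $X$ be a finite commutable set. The finite-state terms of $\mathcal{T}X$ are closed under the pre-Kleene algebra operations: $0$, $1$ and every symbol $x\in X$ are finite state; if $e_1,e_2$ are finite state then so are $e_1+e_2$ and $e_1e_2$; and if $e$ is finite state with $[e]_0=0$ then $e^*$ is finite state. Moreover, the set of states of the corresponding automata can be effectively computed.
   Context: Pre-Kleene algebra: constants $0,1$, operations $+,\cdot,{}^*$ with $(+,0)$ a commutative idempotent monoid, $(\cdot,1)$ a monoid, two-sided distributivity, $0$ absorbing, and $x^*=1+xx^*$. A commutable set is a set with a reflexive symmetric relation $\sim$. $\mathcal{T}X$ is the pre-Kleene algebra freely generated by $X$ subject to $xy=yx$ for $x\sim y$. $[-]_0:\mathcal{T}X\to\{0\le1\}$ is the morphism to the two-element algebra sending each $x\in X$ to $0$ (values regarded as $0,1\in\mathcal{T}X$). A term $e$ is derivable if there is a family $\{\delta_x(e)\}_{x\in X}$ with $e=[e]_0+\sum_{x\in X}x\,\delta_x(e)$. A finite-state automaton is a finite set $S\subseteq\mathcal{T}X$ containing $1$, closed under finite sums, such that every $e\in S$ is derivable via a family with each $\delta_x(e)\in S$. A term is finite state if it belongs to some finite-state automaton. -}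

module Defs where

open import Data.Nat using (ℕ; zero; suc)
open import Data.Fin using (Fin; zero; suc)
open import Data.Bool using (Bool; true; false; _∧_; _∨_)
open import Data.List using (List)
open import Data.List.Relation.Unary.Any using (Any)
open import Data.List.Relation.Unary.All using (All)
open import Data.Product using (Σ; _×_)
open import Level using (Level; _⊔_) renaming (suc to lsuc)
open import Relation.Binary.PropositionalEquality using (_≡_)

record Commutable (n : ℕ) : Set₁ where
  field
    _∼_   : Fin n → Fin n → Set
    ∼-refl : ∀ x → x ∼ x
    ∼-sym  : ∀ {x y} → x ∼ y → y ∼ x

data Term (n : ℕ) : Set where
  𝟘 𝟙  : Term n
  var  : Fin n → Term n
  _⊕_  : Term n → Term n → Term n
  _⊙_  : Term n → Term n → Term n
  _⋆   : Term n → Term n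

infixl 6 _⊕_
infixl 7 _⊙_
infix 8 _⋆

module _ {n : ℕ} (C : Commutable n) where
  open Commutable C

  -- Equality in 𝒯X: least congruence containing the pre-Kleene axioms
  -- and the commutations xy = yx for x ∼ y.
  infix 4 _≈_
  data _≈_ : Term n → Term n → Set where
    ≈-refl  : ∀ {a} → a ≈ a
    ≈-sym   : ∀ {a b} → a ≈ b → b ≈ a
    ≈-trans : ∀ {a b c} → a ≈ b → b ≈ c → a ≈ c
    ⊕-cong  : ∀ {a a' b b'} → a ≈ a' → b ≈ b' → a ⊕ b ≈ a' ⊕ b'
    ⊙-cong  : ∀ {a a' b b'} → a ≈ a' → b ≈ b' → a ⊙ b ≈ a' ⊙ b'
    ⋆-cong  : ∀ {a a'} → a ≈ a' → a ⋆ ≈ a' ⋆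
    ⊕-assoc : ∀ a b c → (a ⊕ b) ⊕ c ≈ a ⊕ (b ⊕ c)
    ⊕-comm  : ∀ a b → a ⊕ b ≈ b ⊕ a
    ⊕-idˡ   : ∀ a → 𝟘 ⊕ a ≈ a
    ⊕-idem  : ∀ a → a ⊕ a ≈ a
    ⊙-assoc : ∀ a b c → (a ⊙ b) ⊙ c ≈ a ⊙ (b ⊙ c)
    ⊙-idˡ   : ∀ a → 𝟙 ⊙ a ≈ a
    ⊙-idʳ   : ∀ a → a ⊙ 𝟙 ≈ a
    distribˡ : ∀ a b c → a ⊙ (b ⊕ c) ≈ (a ⊙ b) ⊕ (a ⊙ c)
    distribʳ : ∀ a b c → (b ⊕ c) ⊙ a ≈ (b ⊙ a) ⊕ (c ⊙ a)
    zeroˡ   : ∀ a → 𝟘 ⊙ a ≈ 𝟘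
    zeroʳ   : ∀ a → a ⊙ 𝟘 ≈ 𝟘
    unfold  : ∀ a → a ⋆ ≈ 𝟙 ⊕ (a ⊙ a ⋆)
    comm    : ∀ {x y} → x ∼ y → var x ⊙ var y ≈ var y ⊙ var x

-- [-]₀ : 𝒯X → {0 ≤ 1}, sending every generator to 0 (computed on terms;
-- it respects ≈ since it is the induced morphism).
[_]₀ᵇ : ∀ {n} → Term n → Bool
[ 𝟘 ]₀ᵇ = false
[ 𝟙 ]₀ᵇ = true
[ var x ]₀ᵇ = false
[ a ⊕ b ]₀ᵇ = [ a ]₀ᵇ ∨ [ b ]₀ᵇ
[ a ⊙ b ]₀ᵇ = [ a ]₀ᵇ ∧ [ b ]₀ᵇ
[ a ⋆ ]₀ᵇ = true

⌜_⌝ : ∀ {n} → Bool → Term n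
⌜ false ⌝ = 𝟘
⌜ true ⌝ = 𝟙

[_]₀ : ∀ {n} → Term n → Term n
[ e ]₀ = ⌜ [ e ]₀ᵇ ⌝

sumFin : ∀ {n m} → (Fin n → Term m) → Term m
sumFin {zero}  f = 𝟘
sumFin {suc n} f = f zero ⊕ sumFin (λ i → f (suc i))

module _ {n : ℕ} (C : Commutable n) where

  _∈ₛ_ : Term n → List (Term n) → Set
  e ∈ₛ S = Any (λ s → _≈_ C e s) S

  DerivableIn : List (Term n) → Term n → Set
  DerivableIn S e =
    Σ (Fin n → Term n) λ δ →
      (∀ x → δ x ∈ₛ S) × _≈_ C e ([ e ]₀ ⊕ sumFin (λ x → var x ⊙ δ x))

  record Automaton : Set where
    field
      states   : List (Term n)
      has-𝟙    : 𝟙 ∈ₛ states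
      has-𝟘    : 𝟘 ∈ₛ states
      closed-⊕ : ∀ {a b} → a ∈ₛ states → b ∈ₛ states → (a ⊕ b) ∈ₛ states
      derivs   : All (DerivableIn states) states

  FiniteState : Term n → Set
  FiniteState e = Σ Automaton λ A → e ∈ₛ Automaton.states A

-- All five closure properties are instances of one construction. Let A₁, A₂ be
-- automata and k a term with  k = [k]₀ + Σₓ x (aₓ k + cₓ)  where aₓ ∈ A₁, cₓ ∈ A₂.
-- Then  A₁ k + A₂ = { s k + t | s ∈ A₁, t ∈ A₂ }  is again an automaton: it is
-- closed under sums by distributivity, and the product rule for derivatives gives
--   s k + t = [s]₀[k]₀ + [t]₀ + Σₓ x ((δₓ s + [s]₀ aₓ) k + ([s]₀ cₓ + δₓ t)),
-- whose derivatives lie in A₁ k + A₂ again, as [s]₀ aₓ is either 0 or aₓ. The instances are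
--   x = 1·x + 0,   e₁ + e₂ = e₁·1 + e₂,   e₁e₂ = e₁e₂ + 0,   e* = 1·e* + 0,
-- with k = x, 1, e₂, e* respectively; for e* the hypothesis [e]₀ = 0 turns the
-- unfolding e* = 1 + e e* into an expansion of the required shape.
module Submission where

open import Defs
open import Data.Nat using (ℕ; zero; suc)
open import Data.Fin using (Fin; zero; suc)
open import Data.Fin.Properties using (_≟_)
open import Data.Bool using (Bool; true; false; _∧_; _∨_)
open import Data.Bool.Properties
  using (∨-assoc; ∨-comm; ∨-idem; ∧-assoc; ∧-identityʳ; ∧-zeroʳ; ∧-distribˡ-∨; ∧-distribʳ-∨)
open import Data.List using (List; []; _∷_; cartesianProductWith)
open import Data.List.Relation.Unary.Any using (here; there)
import Data.List.Relation.Unary.All as All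
open import Data.List.Relation.Unary.All.Properties using (cartesianProductWith⁺)
open import Data.List.Membership.Setoid.Properties
  using (∈-resp-≈; ∈-cartesianProductWith⁺; ∈-cartesianProductWith⁻)
open import Data.Product using (Σ; _×_; _,_)
open import Level using (0ℓ)
open import Relation.Nullary.Decidable using (does)
open import Relation.Binary.Definitions using (_Respects_)
open import Relation.Binary.PropositionalEquality using (_≡_; cong; cong₂)
import Relation.Binary.PropositionalEquality as ≡
open import Algebra.Bundles using (Semiring)
import Algebra.Properties.Semiring.Sum as SemiringSum
import Algebra.Properties.CommutativeSemigroup as CommutativeSemigroupProperties

module Closure {n : ℕ} (C : Commutable n) where

  infix 4 _≋_
  _≋_ : Term n → Term n → Set
  _≋_ = _≈_ C

  termSemiring : Semiring 0ℓ 0ℓ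
  termSemiring = record
    { Carrier = Term n ; _≈_ = _≋_ ; _+_ = _⊕_ ; _*_ = _⊙_ ; 0# = 𝟘 ; 1# = 𝟙
    ; isSemiring = record
      { isSemiringWithoutAnnihilatingZero = record
        { +-isCommutativeMonoid = record
          { isMonoid = record
            { isSemigroup = record
              { isMagma = record
                { isEquivalence = record { refl = ≈-refl ; sym = ≈-sym ; trans = ≈-trans }
                ; ∙-cong = ⊕-cong }
              ; assoc = ⊕-assoc }
            ; identity = ⊕-idˡ , λ a → ≈-trans (⊕-comm a 𝟘) (⊕-idˡ a) }
          ; comm = ⊕-comm }
        ; *-cong = ⊙-cong ; *-assoc = ⊙-assoc ; *-identity = ⊙-idˡ , ⊙-idʳ
        ; distrib = distribˡ , distribʳ }
      ; zero = zeroˡ , zeroʳ } }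

  open Semiring termSemiring
    using (setoid; refl; sym; trans; reflexive; +-congˡ; +-congʳ; *-congˡ; *-congʳ;
           +-identityʳ; +-assoc; +-commutativeSemigroup)
  open SemiringSum termSemiring
    using (sum; sum-cong-≋; ∑-distrib-+; *-distribˡ-sum; *-distribʳ-sum; sum-replicate-zero)
  open CommutativeSemigroupProperties +-commutativeSemigroup using (interchange; xy∙z≈xz∙y)
  open import Relation.Binary.Reasoning.Setoid setoid
  open import Data.List.Membership.Setoid setoid using (_∈_)

  []₀-cong : ∀ {a b} → a ≋ b → [ a ]₀ᵇ ≡ [ b ]₀ᵇ
  []₀-cong ≈-refl               = ≡.refl
  []₀-cong (≈-sym p)            = ≡.sym ([]₀-cong p)
  []₀-cong (≈-trans p q)        = ≡.trans ([]₀-cong p) ([]₀-cong q)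
  []₀-cong (⊕-cong p q)         = cong₂ _∨_ ([]₀-cong p) ([]₀-cong q)
  []₀-cong (⊙-cong p q)         = cong₂ _∧_ ([]₀-cong p) ([]₀-cong q)
  []₀-cong (⋆-cong p)           = ≡.refl
  []₀-cong (⊕-assoc a b c)      = ∨-assoc [ a ]₀ᵇ [ b ]₀ᵇ [ c ]₀ᵇ
  []₀-cong (⊕-comm a b)         = ∨-comm [ a ]₀ᵇ [ b ]₀ᵇ
  []₀-cong (⊕-idˡ a)            = ≡.refl
  []₀-cong (⊕-idem a)           = ∨-idem [ a ]₀ᵇ
  []₀-cong (⊙-assoc a b c)      = ∧-assoc [ a ]₀ᵇ [ b ]₀ᵇ [ c ]₀ᵇ
  []₀-cong (⊙-idˡ a)            = ≡.refl
  []₀-cong (⊙-idʳ a)            = ∧-identityʳ [ a ]₀ᵇ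
  []₀-cong (distribˡ a b c)     = ∧-distribˡ-∨ [ a ]₀ᵇ [ b ]₀ᵇ [ c ]₀ᵇ
  []₀-cong (distribʳ a b c)     = ∧-distribʳ-∨ [ a ]₀ᵇ [ b ]₀ᵇ [ c ]₀ᵇ
  []₀-cong (zeroˡ a)            = ≡.refl
  []₀-cong (zeroʳ a)            = ∧-zeroʳ [ a ]₀ᵇ
  []₀-cong (unfold a)           = ≡.refl
  []₀-cong (comm x∼y)           = ≡.refl

  ⌜⌝-∧ : ∀ b c → ⌜ b ⌝ ⊙ ⌜ c ⌝ ≋ ⌜ b ∧ c ⌝
  ⌜⌝-∧ false c = zeroˡ ⌜ c ⌝
  ⌜⌝-∧ true  c = ⊙-idˡ ⌜ c ⌝

  ⌜⌝-∨ : ∀ b c → ⌜ b ⌝ ⊕ ⌜ c ⌝ ≋ ⌜ b ∨ c ⌝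
  ⌜⌝-∨ false c     = ⊕-idˡ ⌜ c ⌝
  ⌜⌝-∨ true  false = +-identityʳ 𝟙
  ⌜⌝-∨ true  true  = ⊕-idem 𝟙

  ⌜⌝-commute : ∀ b u d → ⌜ b ⌝ ⊙ (u ⊙ d) ≋ u ⊙ (⌜ b ⌝ ⊙ d)
  ⌜⌝-commute false u d = trans (zeroˡ _) (trans (sym (zeroʳ u)) (*-congˡ (sym (zeroˡ d))))
  ⌜⌝-commute true  u d = trans (⊙-idˡ _) (*-congˡ (sym (⊙-idˡ d)))

  ∑var : (Fin n → Term n) → Term n
  ∑var δ = sum (λ x → var x ⊙ δ x)

  sumFin≋sum : ∀ {m} (f : Fin m → Term n) → sumFin f ≋ sum f
  sumFin≋sum {zero}  f = refl
  sumFin≋sum {suc m} f = +-congˡ (sumFin≋sum (λ i → f (suc i)))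

  sum-⊙-𝟘 : ∀ {m} (v : Fin m → Term n) → sum (λ y → v y ⊙ 𝟘) ≋ 𝟘
  sum-⊙-𝟘 {m} v = trans (sum-cong-≋ (λ y → zeroʳ (v y))) (sum-replicate-zero m)

  sum-select : ∀ {m} (v : Fin m → Term n) x → sum (λ y → v y ⊙ ⌜ does (x ≟ y) ⌝) ≋ v x
  sum-select v zero    = trans (⊕-cong (⊙-idʳ (v zero)) (sum-⊙-𝟘 (λ y → v (suc y))))
                               (+-identityʳ (v zero))
  sum-select v (suc x) = trans (⊕-cong (zeroʳ (v zero)) (sum-select (λ y → v (suc y)) x))
                               (⊕-idˡ (v (suc x)))

  ∑var-cong : ∀ {f g} → (∀ x → f x ≋ g x) → ∑var f ≋ ∑var g
  ∑var-cong f≋g = sum-cong-≋ (λ x → *-congˡ (f≋g x))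

  ∑var-⊕ : ∀ f g → ∑var f ⊕ ∑var g ≋ ∑var (λ x → f x ⊕ g x)
  ∑var-⊕ f g = sym (trans (sum-cong-≋ (λ x → distribˡ (var x) (f x) (g x)))
                          (∑-distrib-+ (λ x → var x ⊙ f x) (λ x → var x ⊙ g x)))

  ∑var-⊙ʳ : ∀ f k → ∑var f ⊙ k ≋ ∑var (λ x → f x ⊙ k)
  ∑var-⊙ʳ f k = trans (*-distribʳ-sum k (λ x → var x ⊙ f x))
                      (sum-cong-≋ (λ x → ⊙-assoc (var x) (f x) k))

  ⌜⌝-⊙-∑var : ∀ b f → ⌜ b ⌝ ⊙ ∑var f ≋ ∑var (λ x → ⌜ b ⌝ ⊙ f x)
  ⌜⌝-⊙-∑var b f = trans (*-distribˡ-sum ⌜ b ⌝ (λ x → var x ⊙ f x))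
                        (sum-cong-≋ (λ x → ⌜⌝-commute b (var x) (f x)))

  expansion-⊕ : ∀ {u v b c f g} → u ≋ ⌜ b ⌝ ⊕ ∑var f → v ≋ ⌜ c ⌝ ⊕ ∑var g →
                u ⊕ v ≋ ⌜ b ∨ c ⌝ ⊕ ∑var (λ x → f x ⊕ g x)
  expansion-⊕ {b = b} {c} {f} {g} u≋ v≋ =
    trans (⊕-cong u≋ v≋) (trans (interchange _ _ _ _) (⊕-cong (⌜⌝-∨ b c) (∑var-⊕ f g)))

  expansion-⊙ : ∀ {s k b c f g} → s ≋ ⌜ b ⌝ ⊕ ∑var f → k ≋ ⌜ c ⌝ ⊕ ∑var g →
                s ⊙ k ≋ ⌜ b ∧ c ⌝ ⊕ ∑var (λ x → ⌜ b ⌝ ⊙ g x ⊕ f x ⊙ k)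
  expansion-⊙ {s} {k} {b} {c} {f} {g} s≋ k≋ = begin
    s ⊙ k
      ≈⟨ trans (*-congʳ s≋) (distribʳ k _ _) ⟩
    ⌜ b ⌝ ⊙ k ⊕ ∑var f ⊙ k
      ≈⟨ ⊕-cong (trans (*-congˡ k≋) (distribˡ ⌜ b ⌝ _ _)) (∑var-⊙ʳ f k) ⟩
    (⌜ b ⌝ ⊙ ⌜ c ⌝ ⊕ ⌜ b ⌝ ⊙ ∑var g) ⊕ ∑var (λ x → f x ⊙ k)
      ≈⟨ +-congʳ (⊕-cong (⌜⌝-∧ b c) (⌜⌝-⊙-∑var b g)) ⟩
    (⌜ b ∧ c ⌝ ⊕ ∑var (λ x → ⌜ b ⌝ ⊙ g x)) ⊕ ∑var (λ x → f x ⊙ k)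
      ≈⟨ trans (+-assoc _ _ _) (+-congˡ (∑var-⊕ _ _)) ⟩
    ⌜ b ∧ c ⌝ ⊕ ∑var (λ x → ⌜ b ⌝ ⊙ g x ⊕ f x ⊙ k)
      ∎

  affine-expansion : ∀ {s t k bs bt bk δs δt} {a c : Fin n → Term n} →
    s ≋ ⌜ bs ⌝ ⊕ ∑var δs → t ≋ ⌜ bt ⌝ ⊕ ∑var δt → k ≋ ⌜ bk ⌝ ⊕ ∑var (λ x → a x ⊙ k ⊕ c x) →
    s ⊙ k ⊕ t ≋ ⌜ (bs ∧ bk) ∨ bt ⌝
                ⊕ ∑var (λ x → (⌜ bs ⌝ ⊙ a x ⊕ δs x) ⊙ k ⊕ (⌜ bs ⌝ ⊙ c x ⊕ δt x))
  affine-expansion {k = k} {bs} {δs = δs} {δt} {a} {c} s≋ t≋ k≋ =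
    trans (expansion-⊕ (expansion-⊙ s≋ k≋) t≋) (+-congˡ (∑var-cong regroup))
    where
    regroup : ∀ x → (⌜ bs ⌝ ⊙ (a x ⊙ k ⊕ c x) ⊕ δs x ⊙ k) ⊕ δt x
                    ≋ (⌜ bs ⌝ ⊙ a x ⊕ δs x) ⊙ k ⊕ (⌜ bs ⌝ ⊙ c x ⊕ δt x)
    regroup x = begin
      (⌜ bs ⌝ ⊙ (a x ⊙ k ⊕ c x) ⊕ δs x ⊙ k) ⊕ δt x
        ≈⟨ +-congʳ (+-congʳ (trans (distribˡ _ _ _) (+-congʳ (sym (⊙-assoc _ _ _))))) ⟩
      ((⌜ bs ⌝ ⊙ a x ⊙ k ⊕ ⌜ bs ⌝ ⊙ c x) ⊕ δs x ⊙ k) ⊕ δt x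
        ≈⟨ trans (+-congʳ (xy∙z≈xz∙y _ _ _)) (+-assoc _ _ _) ⟩
      (⌜ bs ⌝ ⊙ a x ⊙ k ⊕ δs x ⊙ k) ⊕ (⌜ bs ⌝ ⊙ c x ⊕ δt x)
        ≈⟨ +-congʳ (sym (distribʳ k _ _)) ⟩
      (⌜ bs ⌝ ⊙ a x ⊕ δs x) ⊙ k ⊕ (⌜ bs ⌝ ⊙ c x ⊕ δt x)
        ∎

  sumFin≋∑var : ∀ δ → sumFin (λ x → var x ⊙ δ x) ≋ ∑var δ
  sumFin≋∑var δ = sumFin≋sum (λ x → var x ⊙ δ x)

  derivableIn-resp : ∀ {S} → DerivableIn C S Respects _≋_
  derivableIn-resp a≋b (δ , δ∈S , a≋) =
    δ , δ∈S , trans (sym a≋b) (trans a≋ (+-congʳ (reflexive (cong ⌜_⌝ ([]₀-cong a≋b)))))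

  open Automaton

  derivable : (A : Automaton C) → ∀ {e} → e ∈ states A → DerivableIn C (states A) e
  derivable A = All.lookupₛ setoid derivableIn-resp (derivs A)

  ⌜⌝-⊙-∈ : (A : Automaton C) → ∀ b {a} → a ∈ states A → ⌜ b ⌝ ⊙ a ∈ states A
  ⌜⌝-⊙-∈ A false a∈A = ∈-resp-≈ setoid (sym (zeroˡ _)) (has-𝟘 A)
  ⌜⌝-⊙-∈ A true  a∈A = ∈-resp-≈ setoid (sym (⊙-idˡ _)) a∈A

  ⌜_⌝-∈ : ∀ b → ⌜ b ⌝ ∈ 𝟘 ∷ 𝟙 ∷ []
  ⌜ false ⌝-∈ = here refl
  ⌜ true  ⌝-∈ = there (here refl)

  constant-derivable : ∀ {S} b → 𝟘 ∈ S → DerivableIn C S ⌜ b ⌝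
  constant-derivable false 𝟘∈S =
    (λ _ → 𝟘) , (λ _ → 𝟘∈S) , sym (trans (+-congˡ (trans (sumFin≋∑var _) (sum-⊙-𝟘 var))) (⊕-idem 𝟘))
  constant-derivable true  𝟘∈S =
    (λ _ → 𝟘) , (λ _ → 𝟘∈S) , sym (trans (+-congˡ (trans (sumFin≋∑var _) (sum-⊙-𝟘 var))) (+-identityʳ 𝟙))

  constants : Automaton C
  constants = record
    { states   = 𝟘 ∷ 𝟙 ∷ []
    ; has-𝟙    = ⌜ true ⌝-∈
    ; has-𝟘    = ⌜ false ⌝-∈
    ; closed-⊕ = closed
    ; derivs   = constant-derivable false ⌜ false ⌝-∈
                 All.∷ constant-derivable true ⌜ false ⌝-∈
                 All.∷ All.[]
    }
    where
    constant : ∀ {a} → a ∈ 𝟘 ∷ 𝟙 ∷ [] → Σ Bool λ b → a ≋ ⌜ b ⌝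
    constant (here a≋𝟘)         = false , a≋𝟘
    constant (there (here a≋𝟙)) = true , a≋𝟙

    closed : ∀ {a b} → a ∈ 𝟘 ∷ 𝟙 ∷ [] → b ∈ 𝟘 ∷ 𝟙 ∷ [] → a ⊕ b ∈ 𝟘 ∷ 𝟙 ∷ []
    closed a∈ b∈ with constant a∈ | constant b∈
    ... | b₁ , a≋ | b₂ , b≋ = ∈-resp-≈ setoid (sym (trans (⊕-cong a≋ b≋) (⌜⌝-∨ b₁ b₂))) ⌜ b₁ ∨ b₂ ⌝-∈

  module Affine (A₁ A₂ : Automaton C) (k : Term n) {a c : Fin n → Term n}
                (a∈A₁ : ∀ x → a x ∈ states A₁) (c∈A₂ : ∀ x → c x ∈ states A₂)
                (k≋ : k ≋ [ k ]₀ ⊕ ∑var (λ x → a x ⊙ k ⊕ c x)) where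

    affine : Term n → Term n → Term n
    affine s t = s ⊙ k ⊕ t

    affineStates : List (Term n)
    affineStates = cartesianProductWith affine (states A₁) (states A₂)

    ∈-affineStates : ∀ {s t} → s ∈ states A₁ → t ∈ states A₂ → affine s t ∈ affineStates
    ∈-affineStates = ∈-cartesianProductWith⁺ setoid setoid setoid (λ s≋ t≋ → ⊕-cong (*-congʳ s≋) t≋)

    affine-⊕ : ∀ s t s′ t′ → affine s t ⊕ affine s′ t′ ≋ affine (s ⊕ s′) (t ⊕ t′)
    affine-⊕ s t s′ t′ = trans (interchange _ _ _ _) (+-congʳ (sym (distribʳ k s s′)))

    closed-affine : ∀ {u v} → u ∈ affineStates → v ∈ affineStates → u ⊕ v ∈ affineStates
    closed-affine u∈ v∈
      with ∈-cartesianProductWith⁻ setoid setoid setoid affine (states A₁) (states A₂) u∈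
         | ∈-cartesianProductWith⁻ setoid setoid setoid affine (states A₁) (states A₂) v∈
    ... | s , t , s∈ , t∈ , u≋ | s′ , t′ , s′∈ , t′∈ , v≋ =
      ∈-resp-≈ setoid (sym (trans (⊕-cong u≋ v≋) (affine-⊕ s t s′ t′)))
        (∈-affineStates (closed-⊕ A₁ s∈ s′∈) (closed-⊕ A₂ t∈ t′∈))

    affine-derivable : ∀ {s t} → DerivableIn C (states A₁) s → DerivableIn C (states A₂) t →
                       DerivableIn C affineStates (affine s t)
    affine-derivable {s} (δs , δs∈ , s≋) (δt , δt∈ , t≋) =
      δ , δ∈ , trans (affine-expansion (trans s≋ (+-congˡ (sumFin≋∑var δs)))
                                       (trans t≋ (+-congˡ (sumFin≋∑var δt))) k≋)
                     (+-congˡ (sym (sumFin≋∑var δ)))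
      where
      δ : Fin n → Term n
      δ x = affine (⌜ [ s ]₀ᵇ ⌝ ⊙ a x ⊕ δs x) (⌜ [ s ]₀ᵇ ⌝ ⊙ c x ⊕ δt x)

      δ∈ : ∀ x → δ x ∈ affineStates
      δ∈ x = ∈-affineStates (closed-⊕ A₁ (⌜⌝-⊙-∈ A₁ _ (a∈A₁ x)) (δs∈ x))
                            (closed-⊕ A₂ (⌜⌝-⊙-∈ A₂ _ (c∈A₂ x)) (δt∈ x))

    automaton : Automaton C
    automaton = record
      { states   = affineStates
      ; has-𝟙    = ∈-resp-≈ setoid (trans (+-congʳ (zeroˡ k)) (⊕-idˡ 𝟙)) (∈-affineStates (has-𝟘 A₁) (has-𝟙 A₂))
      ; has-𝟘    = ∈-resp-≈ setoid (trans (+-congʳ (zeroˡ k)) (⊕-idˡ 𝟘)) (∈-affineStates (has-𝟘 A₁) (has-𝟘 A₂))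
      ; closed-⊕ = closed-affine
      ; derivs   = cartesianProductWith⁺ setoid setoid affine (states A₁) (states A₂)
                     (λ s∈ t∈ → affine-derivable (derivable A₁ s∈) (derivable A₂ t∈))
      }

    affine-finiteState : ∀ {s t} → s ∈ states A₁ → t ∈ states A₂ → FiniteState C (s ⊙ k ⊕ t)
    affine-finiteState s∈ t∈ = automaton , ∈-affineStates s∈ t∈

  open Affine using (affine-finiteState)

  finiteState-resp : FiniteState C Respects _≋_
  finiteState-resp a≋b (A , a∈A) = A , ∈-resp-≈ setoid a≋b a∈A

  𝟘-coefficient : ∀ k c → 𝟘 ⊙ k ⊕ c ≋ c
  𝟘-coefficient k c = trans (+-congʳ (zeroˡ k)) (⊕-idˡ c)

  𝟘-finiteState : FiniteState C 𝟘
  𝟘-finiteState = constants , ⌜ false ⌝-∈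

  𝟙-finiteState : FiniteState C 𝟙
  𝟙-finiteState = constants , ⌜ true ⌝-∈

  var-finiteState : ∀ x → FiniteState C (var x)
  var-finiteState x =
    finiteState-resp (trans (+-identityʳ _) (⊙-idˡ (var x)))
      (affine-finiteState constants constants (var x) (λ _ → ⌜ false ⌝-∈) (λ y → ⌜ does (x ≟ y) ⌝-∈)
        var-expansion ⌜ true ⌝-∈ ⌜ false ⌝-∈)
    where
    var-expansion : var x ≋ 𝟘 ⊕ ∑var (λ y → 𝟘 ⊙ var x ⊕ ⌜ does (x ≟ y) ⌝)
    var-expansion = sym (trans (⊕-idˡ _) (trans (∑var-cong (λ y → 𝟘-coefficient (var x) _))
                                                (sum-select var x)))

  ⊕-finiteState : ∀ {e₁ e₂} → FiniteState C e₁ → FiniteState C e₂ → FiniteState C (e₁ ⊕ e₂)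
  ⊕-finiteState (A₁ , e₁∈) (A₂ , e₂∈) =
    finiteState-resp (+-congʳ (⊙-idʳ _))
      (affine-finiteState A₁ A₂ 𝟙 (λ _ → has-𝟘 A₁) (λ _ → has-𝟘 A₂) 𝟙-expansion e₁∈ e₂∈)
    where
    𝟙-expansion : 𝟙 ≋ 𝟙 ⊕ ∑var (λ _ → 𝟘 ⊙ 𝟙 ⊕ 𝟘)
    𝟙-expansion = sym (trans (+-congˡ (trans (∑var-cong (λ _ → 𝟘-coefficient 𝟙 𝟘)) (sum-⊙-𝟘 var)))
                             (+-identityʳ 𝟙))

  ⊙-finiteState : ∀ {e₁ e₂} → FiniteState C e₁ → FiniteState C e₂ → FiniteState C (e₁ ⊙ e₂)
  ⊙-finiteState {e₁} {e₂} (A₁ , e₁∈) (A₂ , e₂∈) with derivable A₂ e₂∈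
  ... | δ , δ∈ , e₂≋ =
    finiteState-resp (+-identityʳ _)
      (affine-finiteState A₁ A₂ e₂ (λ _ → has-𝟘 A₁) δ∈ e₂-expansion e₁∈ (has-𝟘 A₂))
    where
    e₂-expansion : e₂ ≋ [ e₂ ]₀ ⊕ ∑var (λ x → 𝟘 ⊙ e₂ ⊕ δ x)
    e₂-expansion =
      trans e₂≋ (+-congˡ (trans (sumFin≋∑var δ) (∑var-cong (λ x → sym (𝟘-coefficient e₂ (δ x))))))

  ⋆-finiteState : ∀ {e} → FiniteState C e → [ e ]₀ᵇ ≡ false → FiniteState C (e ⋆)
  ⋆-finiteState {e} (A , e∈) e₀≡false with derivable A e∈
  ... | δ , δ∈ , e≋ =
    finiteState-resp (trans (+-identityʳ _) (⊙-idˡ (e ⋆)))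
      (affine-finiteState A constants (e ⋆) δ∈ (λ _ → ⌜ false ⌝-∈) e⋆-expansion (has-𝟙 A) ⌜ false ⌝-∈)
    where
    e-linear : e ≋ ∑var δ
    e-linear = trans e≋ (trans (⊕-cong (reflexive (cong ⌜_⌝ e₀≡false)) (sumFin≋∑var δ)) (⊕-idˡ _))
    e⋆-expansion : e ⋆ ≋ 𝟙 ⊕ ∑var (λ x → δ x ⊙ e ⋆ ⊕ 𝟘)
    e⋆-expansion = begin
      e ⋆                              ≈⟨ unfold e ⟩
      𝟙 ⊕ e ⊙ e ⋆                      ≈⟨ +-congˡ (*-congʳ e-linear) ⟩
      𝟙 ⊕ ∑var δ ⊙ e ⋆                 ≈⟨ +-congˡ (∑var-⊙ʳ δ (e ⋆)) ⟩
      𝟙 ⊕ ∑var (λ x → δ x ⊙ e ⋆)       ≈⟨ +-congˡ (∑var-cong (λ x → sym (+-identityʳ _))) ⟩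
      𝟙 ⊕ ∑var (λ x → δ x ⊙ e ⋆ ⊕ 𝟘)   ∎

mainTheorem12 : ∀ {n : ℕ} (C : Commutable n) →
    FiniteState C 𝟘 × FiniteState C 𝟙 × (∀ (x : Fin n) → FiniteState C (var x))
    × (∀ {e₁ e₂ : Term n} → FiniteState C e₁ → FiniteState C e₂ → FiniteState C (e₁ ⊕ e₂))
    × (∀ {e₁ e₂ : Term n} → FiniteState C e₁ → FiniteState C e₂ → FiniteState C (e₁ ⊙ e₂))
    × (∀ {e : Term n} → FiniteState C e → [ e ]₀ᵇ ≡ false → FiniteState C (e ⋆))
mainTheorem12 C =
  𝟘-finiteState , 𝟙-finiteState , var-finiteState , ⊕-finiteState , ⊙-finiteState , ⋆-finiteState
  where open Closure C
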